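{- Let $R$ be an extended regular expression with $k$ extended operators, and let $CS$ be the cluster partition of the parse tree $T(R)$. Then: (i) a leaf cluster in $CS$ contains no extended nodes; (ii) each internal cluster in $CS$ contains exactly one extended node; and (iii) the total number of clusters in $CS$ is $O(k)$.
   Context: Extended regular expressions are built from characters of an alphabet $\Sigma$ and $\epsilon$ using concatenation, union $\mid$, intersection $\cap$, complement $\neg$ and star $^*$; intersection and complement are the extended operators, and $k$ is the number of occurrences of them in $R$. The parse tree $T(R)$ is the rooted binary tree whose leaves are labeled by characters in $\Sigma\cup\{\epsilon\}$ and whose internal nodes are labeled by operators ($\odot,\mid,\cap$ with two children; $\neg,^*$ with one child). The set $P$ of extended nodes consists of the nodes $v$ of $T(R)$ such that (a) $v$ is labeled by an extended operator, or (b) $v$ is the lowest common ancestor of two nodes labeled by extended operators. Edges of $T(R)$ from a node $p\in P$ to its children are called external; all other edges are internal. Deleting all external edges partitions $T(R)$ into node-disjoint connected subtrees called clusters; the set of clusters is the cluster partition $CS$. Contracting all internal edges yields the macro tree, whose nodes are the clusters; a leaf cluster is a leaf of the macro tree and an internal cluster is a non-leaf of the macro tree. -}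

module Defs where

open import Data.Nat using (ℕ; zero; suc; _+_; _*_)
open import Data.Fin using (Fin; zero; suc)
open import Data.Unit using (⊤)
open import Data.Empty using (⊥)
open import Data.Product using (Σ; _×_; ∃)
open import Data.Sum using (_⊎_)
open import Relation.Nullary using (¬_)
open import Relation.Binary.PropositionalEquality using (_≡_)
open import Relation.Binary.Construct.Closure.Equivalence using (EqClosure)

-- A value of this type
-- *is* its parse tree T(R): leaves are characters or ε, internal nodes are
-- labelled ⊙ (concatenation), ∣ (union), ∩ (intersection), ∁ (complement), ⋆ (star).
data ERE (A : Set) : Set where
  chr  : A → ERE A
  eps  : ERE A
  _⊙_  : ERE A → ERE A → ERE A
  _∣_  : ERE A → ERE A → ERE A
  _∩_  : ERE A → ERE A → ERE A
  ∁_   : ERE A → ERE A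
  _⋆   : ERE A → ERE A

module _ {A : Set} where

  arity : ERE A → ℕ
  arity (chr _) = 0
  arity eps     = 0
  arity (_ ⊙ _) = 2
  arity (_ ∣ _) = 2
  arity (_ ∩ _) = 2
  arity (∁ _)   = 1
  arity (_ ⋆)   = 1

  child : (r : ERE A) → Fin (arity r) → ERE A
  child (r ⊙ s) zero       = r
  child (r ⊙ s) (suc zero) = s
  child (r ∣ s) zero       = r
  child (r ∣ s) (suc zero) = s
  child (r ∩ s) zero       = r
  child (r ∩ s) (suc zero) = s
  child (∁ r)   zero       = r
  child (r ⋆)   zero       = r

  ExtOp : ERE A → Set
  ExtOp (_ ∩ _) = ⊤
  ExtOp (∁ _)   = ⊤
  ExtOp _       = ⊥

  numExt : ERE A → ℕ
  numExt (chr _) = 0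
  numExt eps     = 0
  numExt (r ⊙ s) = numExt r + numExt s
  numExt (r ∣ s) = numExt r + numExt s
  numExt (r ∩ s) = suc (numExt r + numExt s)
  numExt (∁ r)   = suc (numExt r)
  numExt (r ⋆)   = numExt r

  -- Nodes of the parse tree T(r), as paths from the root.
  data Pos : ERE A → Set where
    root : ∀ {r} → Pos r
    down : ∀ {r} (i : Fin (arity r)) → Pos (child r i) → Pos r

  -- subtree rooted at a node (its label is the root of this subtree)
  sub : ∀ {r} → Pos r → ERE A
  sub {r} root = r
  sub (down i p) = sub p

  childOf : ∀ {r} (p : Pos r) → Fin (arity (sub p)) → Pos r
  childOf root i       = down i root
  childOf (down j p) i = down j (childOf p i)

  data _≼_ {r : ERE A} : Pos r → Pos r → Set where
    root≼ : ∀ {q} → root ≼ q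
    down≼ : ∀ {i p q} → p ≼ q → down i p ≼ down i q

  IsLCA : ∀ {r} → Pos r → Pos r → Pos r → Set
  IsLCA p a b = p ≼ a × p ≼ b × (∀ q → q ≼ a → q ≼ b → q ≼ p)

  IsExtended : ∀ {r} → Pos r → Set
  IsExtended {r} p =
    ExtOp (sub p) ⊎
    Σ (Pos r) λ a → Σ (Pos r) λ b → ExtOp (sub a) × ExtOp (sub b) × IsLCA p a b

  InternalEdge : ∀ {r} → Pos r → Pos r → Set
  InternalEdge p q = ¬ IsExtended p × Σ (Fin (arity (sub p))) λ i → q ≡ childOf p i

  SameCluster : ∀ {r} → Pos r → Pos r → Set
  SameCluster = EqClosure InternalEdge

  -- the cluster of x is a leaf of the macro tree: no external edge
  -- (edge from a node of P to a child) leaves it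
  LeafCluster : ∀ {r} → Pos r → Set
  LeafCluster {r} x =
    ¬ (Σ (Pos r) λ p → SameCluster x p × IsExtended p × Fin (arity (sub p)))

-- Whether a node is extended depends only on the subtree below it: it is an
-- ∩ or ∁ node, or a binary node both of whose subtrees contain an extended
-- operator.  Hence every cluster is the part of the subtree below its top
-- (the root, or a child of an extended node) that lies above the extended
-- nodes.  Two extended nodes of one cluster would lie below distinct children
-- of a non-extended node of that cluster, which would then be extended; so
-- each cluster has at most one.  Finally an induction on R shows that there
-- are at most 4k children of extended nodes, hence at most 4k + 1 clusters.
module Submission where

open import Defs
open import Data.Bool using (Bool; true; false; _∧_; _∨_; if_then_else_)
open import Data.Bool.Properties using (∨-zeroʳ; ∧-conicalˡ; ∧-conicalʳ)
import Data.Bool.Properties as Bool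
open import Data.Fin using (Fin; zero; suc)
import Data.Fin.Properties as Fin
open import Data.List using (List; []; _∷_; [_]; _++_; map; length)
open import Data.List.Properties using (length-map; length-++; length-removeAt′)
open import Data.List.Membership.Propositional using (_∈_; _─_; lose)
open import Data.List.Membership.Propositional.Properties using (∈-map⁺; ∈-map⁻; ∈-++⁺ˡ; ∈-++⁺ʳ)
open import Data.List.Relation.Binary.Subset.Propositional using (_⊆_)
open import Data.List.Relation.Binary.Subset.Propositional.Properties using (∷⁺ʳ)
import Data.List.Relation.Unary.All as All
open import Data.List.Relation.Unary.AllPairs using (AllPairs; []; _∷_)
open import Data.List.Relation.Unary.Any using (here; there; index; satisfied; any?)
open import Data.List.Relation.Unary.Unique.Propositional using (Unique)
import Data.List.Relation.Unary.Unique.Setoid.Properties as Unique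
open import Data.Nat using (ℕ; zero; suc; _+_; _*_; _≤_; z≤n; s≤s)
open import Data.Nat.Properties
  using (≤-trans; n≤1+n; m≤m+n; m≤n+m; +-mono-≤; +-monoʳ-≤; *-monoʳ-≤;
         +-suc; +-identityʳ; +-comm; *-suc; *-distribˡ-+; module ≤-Reasoning)
open import Data.Product using (Σ; ∃; _×_; _,_)
open import Data.Sum using (_⊎_; inj₁; inj₂)
open import Data.Unit using (tt)
open import Function using (_∘_)
open import Relation.Binary.Construct.Closure.Equivalence as EqClosure using ()
open import Relation.Binary.PropositionalEquality
  using (_≡_; _≢_; refl; sym; trans; cong; cong₂; subst; isEquivalence; setoid)
open import Relation.Nullary using (¬_; Dec; yes; no; contradiction)
open import Relation.Nullary.Decidable using (map′; _×-dec_; decidable-stable)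
open import Relation.Unary using (Pred; Decidable)

Unique⇒length≤ : ∀ {a} {X : Set a} {xs ys : List X} → Unique xs → xs ⊆ ys → length xs ≤ length ys
Unique⇒length≤ [] _ = z≤n
Unique⇒length≤ {xs = x ∷ xs} {ys} (x∉xs ∷ unique) xs⊆ys = begin
  suc (length xs)              ≤⟨ s≤s (Unique⇒length≤ unique (λ y∈xs → ∈-─ (All.lookup x∉xs y∈xs) x∈ys (xs⊆ys (there y∈xs)))) ⟩
  suc (length (ys ─ x∈ys))     ≡⟨ sym (length-removeAt′ ys (index x∈ys)) ⟩
  length ys                    ∎
  where
  open ≤-Reasoning
  x∈ys : x ∈ ys
  x∈ys = xs⊆ys (here refl)
  ∈-─ : ∀ {x y} {zs : List _} → x ≢ y → (x∈zs : x ∈ zs) → y ∈ zs → y ∈ zs ─ x∈zs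
  ∈-─ x≢y (here refl) (here refl) = contradiction refl x≢y
  ∈-─ x≢y (here refl) (there y∈zs) = y∈zs
  ∈-─ x≢y (there _) (here refl) = here refl
  ∈-─ x≢y (there x∈zs) (there y∈zs) = there (∈-─ x≢y x∈zs y∈zs)

true≢false : true ≢ false
true≢false ()

-- Relates the number n of children of extended nodes to the number k of
-- extended operators, b recording whether k > 0.  The slack 2 pays for the
-- two children of a binary node both of whose subtrees contain an extended operator.
ExtChildrenBound : Bool → ℕ → ℕ → Set
ExtChildrenBound false n k = n ≡ 0
ExtChildrenBound true  n k = 2 + n ≤ 4 * k

ExtChildrenBound⇒≤ : ∀ b {n k} → ExtChildrenBound b n k → n ≤ 4 * k
ExtChildrenBound⇒≤ false refl = z≤n
ExtChildrenBound⇒≤ true  {n} bound = ≤-trans (m≤n+m n 2) bound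

ExtChildrenBound-binary : ∀ b₁ b₂ {n₁ n₂ k₁ k₂} → ExtChildrenBound b₁ n₁ k₁ → ExtChildrenBound b₂ n₂ k₂ →
  ExtChildrenBound (b₁ ∨ b₂) ((if b₁ ∧ b₂ then suc n₁ else n₁) + (if b₁ ∧ b₂ then suc n₂ else n₂)) (k₁ + k₂)
ExtChildrenBound-binary true true {n₁} {n₂} {k₁} {k₂} bound₁ bound₂ = begin
  2 + (suc n₁ + suc n₂)  ≡⟨ cong (2 +_) (sym (+-suc n₁ (suc n₂))) ⟩
  (2 + n₁) + (2 + n₂)    ≤⟨ +-mono-≤ bound₁ bound₂ ⟩
  4 * k₁ + 4 * k₂        ≡⟨ sym (*-distribˡ-+ 4 k₁ k₂) ⟩
  4 * (k₁ + k₂)          ∎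
  where open ≤-Reasoning
ExtChildrenBound-binary true false {n₁} {k₁ = k₁} {k₂} bound₁ refl = begin
  2 + (n₁ + 0)           ≡⟨ cong (2 +_) (+-identityʳ n₁) ⟩
  2 + n₁                 ≤⟨ bound₁ ⟩
  4 * k₁                 ≤⟨ *-monoʳ-≤ 4 (m≤m+n k₁ k₂) ⟩
  4 * (k₁ + k₂)          ∎
  where open ≤-Reasoning
ExtChildrenBound-binary false true {k₁ = k₁} {k₂} refl bound₂ = ≤-trans bound₂ (*-monoʳ-≤ 4 (m≤n+m k₂ k₁))
ExtChildrenBound-binary false false refl refl = refl

ExtChildrenBound-∩ : ∀ {n₁ n₂ k₁ k₂} → n₁ ≤ 4 * k₁ → n₂ ≤ 4 * k₂ →
                     ExtChildrenBound true (suc n₁ + suc n₂) (suc (k₁ + k₂))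
ExtChildrenBound-∩ {n₁} {n₂} {k₁} {k₂} bound₁ bound₂ = begin
  2 + (suc n₁ + suc n₂)  ≡⟨ cong (3 +_) (+-suc n₁ n₂) ⟩
  4 + (n₁ + n₂)          ≤⟨ +-monoʳ-≤ 4 (+-mono-≤ bound₁ bound₂) ⟩
  4 + (4 * k₁ + 4 * k₂)  ≡⟨ cong (4 +_) (sym (*-distribˡ-+ 4 k₁ k₂)) ⟩
  4 + 4 * (k₁ + k₂)      ≡⟨ sym (*-suc 4 (k₁ + k₂)) ⟩
  4 * suc (k₁ + k₂)      ∎
  where open ≤-Reasoning

ExtChildrenBound-∁ : ∀ {n k} → n ≤ 4 * k → ExtChildrenBound true (suc n) (suc k)
ExtChildrenBound-∁ {n} {k} bound = begin
  3 + n                  ≤⟨ n≤1+n (3 + n) ⟩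
  4 + n                  ≤⟨ +-monoʳ-≤ 4 bound ⟩
  4 + 4 * k              ≡⟨ sym (*-suc 4 k) ⟩
  4 * suc k              ∎
  where open ≤-Reasoning

module _ {A : Set} where

  containsExtOp : ERE A → Bool
  containsExtOp (chr _) = false
  containsExtOp eps     = false
  containsExtOp (r ⊙ s) = containsExtOp r ∨ containsExtOp s
  containsExtOp (r ∣ s) = containsExtOp r ∨ containsExtOp s
  containsExtOp (_ ∩ _) = true
  containsExtOp (∁ _)   = true
  containsExtOp (r ⋆)   = containsExtOp r

  isExtendedRoot : ERE A → Bool
  isExtendedRoot (r ⊙ s) = containsExtOp r ∧ containsExtOp s
  isExtendedRoot (r ∣ s) = containsExtOp r ∧ containsExtOp s
  isExtendedRoot (_ ∩ _) = true
  isExtendedRoot (∁ _)   = true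
  isExtendedRoot _       = false

  containsExtOp-child : (r : ERE A) (i : Fin (arity r)) →
                        containsExtOp (child r i) ≡ true → containsExtOp r ≡ true
  containsExtOp-child (r ⊙ s) zero       c = cong (_∨ containsExtOp s) c
  containsExtOp-child (r ⊙ s) (suc zero) c = trans (cong (containsExtOp r ∨_) c) (∨-zeroʳ _)
  containsExtOp-child (r ∣ s) zero       c = cong (_∨ containsExtOp s) c
  containsExtOp-child (r ∣ s) (suc zero) c = trans (cong (containsExtOp r ∨_) c) (∨-zeroʳ _)
  containsExtOp-child (_ ∩ _) _          _ = refl
  containsExtOp-child (∁ _)   _          _ = refl
  containsExtOp-child (_ ⋆)   zero       c = c

  containsExtOp-sub : ∀ {s : ERE A} (p : Pos s) → containsExtOp (sub p) ≡ true → containsExtOp s ≡ true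
  containsExtOp-sub root       c = c
  containsExtOp-sub {s} (down i p) c = containsExtOp-child s i (containsExtOp-sub p c)

  isExtendedRoot⇒containsExtOp : (s : ERE A) → isExtendedRoot s ≡ true → containsExtOp s ≡ true
  isExtendedRoot⇒containsExtOp (r ⊙ s) e = cong (_∨ containsExtOp s) (∧-conicalˡ _ _ e)
  isExtendedRoot⇒containsExtOp (r ∣ s) e = cong (_∨ containsExtOp s) (∧-conicalˡ _ _ e)
  isExtendedRoot⇒containsExtOp (_ ∩ _) _ = refl
  isExtendedRoot⇒containsExtOp (∁ _)   _ = refl

  ExtOp⇒isExtendedRoot : (s : ERE A) → ExtOp s → isExtendedRoot s ≡ true
  ExtOp⇒isExtendedRoot (_ ∩ _) _ = refl
  ExtOp⇒isExtendedRoot (∁ _)   _ = refl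

  isExtendedRoot-sub⇒containsExtOp : ∀ {s : ERE A} (p : Pos s) → isExtendedRoot (sub p) ≡ true → containsExtOp s ≡ true
  isExtendedRoot-sub⇒containsExtOp p e = containsExtOp-sub p (isExtendedRoot⇒containsExtOp (sub p) e)

  ExtOp⇒containsExtOp : ∀ {s : ERE A} (a : Pos s) → ExtOp (sub a) → containsExtOp s ≡ true
  ExtOp⇒containsExtOp a e = isExtendedRoot-sub⇒containsExtOp a (ExtOp⇒isExtendedRoot (sub a) e)

  containsExtOp⇒ExtOp : (s : ERE A) → containsExtOp s ≡ true → Σ (Pos s) λ a → ExtOp (sub a)
  containsExtOp⇒ExtOp (r ⊙ s) c with containsExtOp r in cr
  ... | true  = let a , e = containsExtOp⇒ExtOp r cr in down zero a , e
  ... | false = let a , e = containsExtOp⇒ExtOp s c  in down (suc zero) a , e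
  containsExtOp⇒ExtOp (r ∣ s) c with containsExtOp r in cr
  ... | true  = let a , e = containsExtOp⇒ExtOp r cr in down zero a , e
  ... | false = let a , e = containsExtOp⇒ExtOp s c  in down (suc zero) a , e
  containsExtOp⇒ExtOp (_ ∩ _) _ = root , tt
  containsExtOp⇒ExtOp (∁ _)   _ = root , tt
  containsExtOp⇒ExtOp (r ⋆)   c = let a , e = containsExtOp⇒ExtOp r c in down zero a , e

  isExtendedRoot-two-children : (r : ERE A) {i j : Fin (arity r)} → i ≢ j →
    containsExtOp (child r i) ≡ true → containsExtOp (child r j) ≡ true → isExtendedRoot r ≡ true
  isExtendedRoot-two-children (r ⊙ s) {zero}     {zero}     i≢j _  _  = contradiction refl i≢j
  isExtendedRoot-two-children (r ⊙ s) {zero}     {suc zero} _   c₁ c₂ = cong₂ _∧_ c₁ c₂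
  isExtendedRoot-two-children (r ⊙ s) {suc zero} {zero}     _   c₁ c₂ = cong₂ _∧_ c₂ c₁
  isExtendedRoot-two-children (r ⊙ s) {suc zero} {suc zero} i≢j _  _  = contradiction refl i≢j
  isExtendedRoot-two-children (r ∣ s) {zero}     {zero}     i≢j _  _  = contradiction refl i≢j
  isExtendedRoot-two-children (r ∣ s) {zero}     {suc zero} _   c₁ c₂ = cong₂ _∧_ c₁ c₂
  isExtendedRoot-two-children (r ∣ s) {suc zero} {zero}     _   c₁ c₂ = cong₂ _∧_ c₂ c₁
  isExtendedRoot-two-children (r ∣ s) {suc zero} {suc zero} i≢j _  _  = contradiction refl i≢j
  isExtendedRoot-two-children (_ ∩ _) _ _ _ = refl
  isExtendedRoot-two-children (∁ _)   _ _ _ = refl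
  isExtendedRoot-two-children (_ ⋆)   {zero} {zero} i≢j _ _ = contradiction refl i≢j

  isExtendedRoot⇒child : (s : ERE A) → isExtendedRoot s ≡ true → Fin (arity s)
  isExtendedRoot⇒child (_ ⊙ _) _ = zero
  isExtendedRoot⇒child (_ ∣ _) _ = zero
  isExtendedRoot⇒child (_ ∩ _) _ = zero
  isExtendedRoot⇒child (∁ _)   _ = zero

  IsExtended-down⁻ : ∀ {r : ERE A} {i} {p : Pos (child r i)} → IsExtended {r = r} (down i p) → IsExtended p
  IsExtended-down⁻ (inj₁ e) = inj₁ e
  IsExtended-down⁻ {i = i} (inj₂ (down _ a , down _ b , ea , eb , down≼ p≼a , down≼ p≼b , lowest)) =
    inj₂ (a , b , ea , eb , p≼a , p≼b , λ q q≼a q≼b → up (lowest (down i q) (down≼ q≼a) (down≼ q≼b)))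
    where
    up : ∀ {q p} → down i q ≼ down i p → q ≼ p
    up (down≼ q≼p) = q≼p

  IsExtended-down⁺ : ∀ {r : ERE A} {i} {p : Pos (child r i)} → IsExtended p → IsExtended {r = r} (down i p)
  IsExtended-down⁺ (inj₁ e) = inj₁ e
  IsExtended-down⁺ {i = i} {p} (inj₂ (a , b , ea , eb , p≼a , p≼b , lowest)) =
    inj₂ (down i a , down i b , ea , eb , down≼ p≼a , down≼ p≼b , lowest′)
    where
    lowest′ : ∀ q → q ≼ down i a → q ≼ down i b → q ≼ down i p
    lowest′ root       _          _          = root≼
    lowest′ (down _ q) (down≼ q≼a) (down≼ q≼b) = down≼ (lowest q q≼a q≼b)

  IsExtended-root-two-children : (r : ERE A) {i j : Fin (arity r)} → i ≢ j →
    containsExtOp (child r i) ≡ true → containsExtOp (child r j) ≡ true → IsExtended {r = r} root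
  IsExtended-root-two-children r {i} {j} i≢j cᵢ cⱼ =
    let a , ea = containsExtOp⇒ExtOp (child r i) cᵢ
        b , eb = containsExtOp⇒ExtOp (child r j) cⱼ
    in inj₂ (down i a , down j b , ea , eb , root≼ , root≼ , lowest)
    where
    index-≼ : ∀ {k l q} {t : Pos (child r l)} → down k q ≼ down l t → k ≡ l
    index-≼ (down≼ _) = refl
    lowest : ∀ {a b} q → q ≼ down i a → q ≼ down j b → q ≼ root
    lowest root       _   _   = root≼
    lowest (down _ _) q≼a q≼b = contradiction (trans (sym (index-≼ q≼a)) (index-≼ q≼b)) i≢j

  isExtendedRoot⇒IsExtended-root : (r : ERE A) → isExtendedRoot r ≡ true → IsExtended {r = r} root
  isExtendedRoot⇒IsExtended-root (r ⊙ s) e =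
    IsExtended-root-two-children (r ⊙ s) {zero} {suc zero} (λ ()) (∧-conicalˡ _ _ e) (∧-conicalʳ _ _ e)
  isExtendedRoot⇒IsExtended-root (r ∣ s) e =
    IsExtended-root-two-children (r ∣ s) {zero} {suc zero} (λ ()) (∧-conicalˡ _ _ e) (∧-conicalʳ _ _ e)
  isExtendedRoot⇒IsExtended-root (_ ∩ _) _ = inj₁ tt
  isExtendedRoot⇒IsExtended-root (∁ _)   _ = inj₁ tt

  IsExtended-root⇒isExtendedRoot : (r : ERE A) → IsExtended {r = r} root → isExtendedRoot r ≡ true
  IsExtended-root⇒isExtendedRoot r (inj₁ e) = ExtOp⇒isExtendedRoot r e
  IsExtended-root⇒isExtendedRoot r (inj₂ (root , _ , ea , _)) = ExtOp⇒isExtendedRoot r ea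
  IsExtended-root⇒isExtendedRoot r (inj₂ (down _ _ , root , _ , eb , _)) = ExtOp⇒isExtendedRoot r eb
  IsExtended-root⇒isExtendedRoot r (inj₂ (down i a , down j b , ea , eb , _ , _ , lowest)) with i Fin.≟ j
  ... | yes refl with lowest (down i root) (down≼ root≼) (down≼ root≼)
  ...   | ()
  IsExtended-root⇒isExtendedRoot r (inj₂ (down i a , down j b , ea , eb , _ , _ , _)) | no i≢j =
    isExtendedRoot-two-children r i≢j (ExtOp⇒containsExtOp a ea) (ExtOp⇒containsExtOp b eb)

  isExtendedRoot⇒IsExtended : ∀ {r : ERE A} (p : Pos r) → isExtendedRoot (sub p) ≡ true → IsExtended p
  isExtendedRoot⇒IsExtended {r} root e = isExtendedRoot⇒IsExtended-root r e
  isExtendedRoot⇒IsExtended (down i p) e = IsExtended-down⁺ (isExtendedRoot⇒IsExtended p e)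

  IsExtended⇒isExtendedRoot : ∀ {r : ERE A} (p : Pos r) → IsExtended p → isExtendedRoot (sub p) ≡ true
  IsExtended⇒isExtendedRoot {r} root e = IsExtended-root⇒isExtendedRoot r e
  IsExtended⇒isExtendedRoot (down i p) e = IsExtended⇒isExtendedRoot p (IsExtended-down⁻ e)

  IsExtended? : ∀ {r : ERE A} → Decidable (IsExtended {r = r})
  IsExtended? p = map′ (isExtendedRoot⇒IsExtended p) (IsExtended⇒isExtendedRoot p) (isExtendedRoot (sub p) Bool.≟ true)

  IsExtended⇒child : ∀ {r : ERE A} (p : Pos r) → IsExtended p → Fin (arity (sub p))
  IsExtended⇒child p e = isExtendedRoot⇒child (sub p) (IsExtended⇒isExtendedRoot p e)

  -- The root of a subtree starts a new cluster exactly when its parent is extended.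
  liftTop : (r : ERE A) (i : Fin (arity r)) → Pos (child r i) → Pos r
  liftTop r i root       = if isExtendedRoot r then down i root else root
  liftTop r i (down j t) = down i (down j t)

  clusterTop : ∀ {r : ERE A} → Pos r → Pos r
  clusterTop root           = root
  clusterTop {r} (down i p) = liftTop r i (clusterTop p)

  clusterTop-childOf : ∀ {r : ERE A} (p : Pos r) (i : Fin (arity (sub p))) →
                       isExtendedRoot (sub p) ≡ false → clusterTop (childOf p i) ≡ clusterTop p
  clusterTop-childOf root       i e rewrite e = refl
  clusterTop-childOf {r} (down j p) i e = cong (liftTop r j) (clusterTop-childOf p i e)

  SameCluster⇒clusterTop≡ : ∀ {r : ERE A} {x y : Pos r} → SameCluster x y → clusterTop x ≡ clusterTop y
  SameCluster⇒clusterTop≡ = EqClosure.gfold isEquivalence clusterTop internalEdge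
    where
    internalEdge : ∀ {p q} → InternalEdge p q → clusterTop p ≡ clusterTop q
    internalEdge {p} (¬ext , i , refl) =
      sym (clusterTop-childOf p i (Bool.¬-not (¬ext ∘ isExtendedRoot⇒IsExtended p)))

  SameCluster-down : ∀ {r : ERE A} {i} {p q : Pos (child r i)} →
                     SameCluster p q → SameCluster {r = r} (down i p) (down i q)
  SameCluster-down {i = i} = EqClosure.gmap (down i) λ (¬ext , j , eq) → ¬ext ∘ IsExtended-down⁻ , j , cong (down i) eq

  SameCluster-liftTop : (r : ERE A) (i : Fin (arity r)) (t : Pos (child r i)) →
                        SameCluster {r = r} (down i t) (liftTop r i t)
  SameCluster-liftTop r i (down _ _) = EqClosure.reflexive _
  SameCluster-liftTop r i root with isExtendedRoot r in e
  ... | true  = EqClosure.reflexive _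
  ... | false = EqClosure.symmetric _ (EqClosure.return (¬ext , i , refl))
    where
    ¬ext : ¬ IsExtended {r = r} root
    ¬ext ext = true≢false (trans (sym (IsExtended-root⇒isExtendedRoot r ext)) e)

  SameCluster-clusterTop : ∀ {r : ERE A} (x : Pos r) → SameCluster x (clusterTop x)
  SameCluster-clusterTop root           = EqClosure.reflexive _
  SameCluster-clusterTop {r} (down i p) =
    EqClosure.transitive _ (SameCluster-down (SameCluster-clusterTop p)) (SameCluster-liftTop r i (clusterTop p))

  clusterTop≡⇒SameCluster : ∀ {r : ERE A} {x y : Pos r} → clusterTop x ≡ clusterTop y → SameCluster x y
  clusterTop≡⇒SameCluster {x = x} {y} eq =
    EqClosure.transitive _ (SameCluster-clusterTop x)
      (subst (λ t → SameCluster t y) (sym eq) (EqClosure.symmetric _ (SameCluster-clusterTop y)))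

  liftTop≡root : (r : ERE A) (i : Fin (arity r)) (t : Pos (child r i)) →
                 liftTop r i t ≡ root → isExtendedRoot r ≡ false
  liftTop≡root r i root eq with isExtendedRoot r
  ... | false = refl
  liftTop≡root r i root () | true

  liftTop-injective : (r : ERE A) {i j : Fin (arity r)} (s : Pos (child r i)) (t : Pos (child r j)) →
                      liftTop r i s ≡ liftTop r j t →
                      (Σ (i ≡ j) λ { refl → s ≡ t }) ⊎ (i ≢ j × isExtendedRoot r ≡ false)
  liftTop-injective r {i} {j} root root eq with i Fin.≟ j
  ... | yes refl = inj₁ (refl , refl)
  ... | no i≢j with isExtendedRoot r
  ...   | false = inj₂ (i≢j , refl)
  liftTop-injective r root root refl | no i≢j | true = contradiction refl i≢j
  liftTop-injective r root (down _ _) eq with isExtendedRoot r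
  liftTop-injective r root (down _ _) () | true
  liftTop-injective r root (down _ _) () | false
  liftTop-injective r (down _ _) root eq with isExtendedRoot r
  liftTop-injective r (down _ _) root () | true
  liftTop-injective r (down _ _) root () | false
  liftTop-injective r (down _ _) (down _ _) refl = inj₁ (refl , refl)

  extended-clusterTop-injective : ∀ {r : ERE A} (x y : Pos r) → isExtendedRoot (sub x) ≡ true → isExtendedRoot (sub y) ≡ true →
                         clusterTop x ≡ clusterTop y → x ≡ y
  extended-clusterTop-injective root root _ _ _ = refl
  extended-clusterTop-injective {r} root (down i q) ex _ eq =
    contradiction (trans (sym ex) (liftTop≡root r i (clusterTop q) (sym eq))) true≢false
  extended-clusterTop-injective {r} (down i p) root _ ey eq =
    contradiction (trans (sym ey) (liftTop≡root r i (clusterTop p) eq)) true≢false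
  extended-clusterTop-injective {r} (down i p) (down j q) ex ey eq with liftTop-injective r (clusterTop p) (clusterTop q) eq
  ... | inj₁ (refl , eq′) = cong (down i) (extended-clusterTop-injective p q ex ey eq′)
  ... | inj₂ (i≢j , ¬ext) = contradiction (trans (sym ext) ¬ext) true≢false
    where
    ext : isExtendedRoot r ≡ true
    ext = isExtendedRoot-two-children r i≢j (isExtendedRoot-sub⇒containsExtOp p ex) (isExtendedRoot-sub⇒containsExtOp q ey)

  IsExtended-unique-in-cluster : ∀ {r : ERE A} {x y z : Pos r} → SameCluster x y → SameCluster x z →
                                 IsExtended y → IsExtended z → z ≡ y
  IsExtended-unique-in-cluster {y = y} {z} x~y x~z exty extz =
    extended-clusterTop-injective z y (IsExtended⇒isExtendedRoot z extz) (IsExtended⇒isExtendedRoot y exty)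
      (trans (sym (SameCluster⇒clusterTop≡ x~z)) (SameCluster⇒clusterTop≡ x~y))

  _≟ₚ_ : ∀ {r : ERE A} (p q : Pos r) → Dec (p ≡ q)
  root     ≟ₚ root     = yes refl
  root     ≟ₚ down _ _ = no λ ()
  down _ _ ≟ₚ root     = no λ ()
  down i p ≟ₚ down j q with i Fin.≟ j
  ... | no i≢j = no λ { refl → i≢j refl }
  ... | yes refl with p ≟ₚ q
  ...   | yes refl = yes refl
  ...   | no p≢q   = no λ { refl → p≢q refl }

  SameCluster? : ∀ {r : ERE A} (x y : Pos r) → Dec (SameCluster x y)
  SameCluster? x y = map′ clusterTop≡⇒SameCluster SameCluster⇒clusterTop≡ (clusterTop x ≟ₚ clusterTop y)

  allPos : (r : ERE A) → List (Pos r)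
  allPos (chr _) = [ root ]
  allPos eps     = [ root ]
  allPos (r ⊙ s) = root ∷ map (down zero) (allPos r) ++ map (down (suc zero)) (allPos s)
  allPos (r ∣ s) = root ∷ map (down zero) (allPos r) ++ map (down (suc zero)) (allPos s)
  allPos (r ∩ s) = root ∷ map (down zero) (allPos r) ++ map (down (suc zero)) (allPos s)
  allPos (∁ r)   = root ∷ map (down zero) (allPos r)
  allPos (r ⋆)   = root ∷ map (down zero) (allPos r)

  ∈-allPos : ∀ {r : ERE A} (p : Pos r) → p ∈ allPos r
  ∈-allPos {chr _} root = here refl
  ∈-allPos {eps}   root = here refl
  ∈-allPos {_ ⊙ _} root = here refl
  ∈-allPos {_ ∣ _} root = here refl
  ∈-allPos {_ ∩ _} root = here refl
  ∈-allPos {∁ _}   root = here refl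
  ∈-allPos {_ ⋆}   root = here refl
  ∈-allPos {_ ⊙ _} (down zero p)       = there (∈-++⁺ˡ (∈-map⁺ _ (∈-allPos p)))
  ∈-allPos {_ ⊙ _} (down (suc zero) p) = there (∈-++⁺ʳ _ (∈-map⁺ _ (∈-allPos p)))
  ∈-allPos {_ ∣ _} (down zero p)       = there (∈-++⁺ˡ (∈-map⁺ _ (∈-allPos p)))
  ∈-allPos {_ ∣ _} (down (suc zero) p) = there (∈-++⁺ʳ _ (∈-map⁺ _ (∈-allPos p)))
  ∈-allPos {_ ∩ _} (down zero p)       = there (∈-++⁺ˡ (∈-map⁺ _ (∈-allPos p)))
  ∈-allPos {_ ∩ _} (down (suc zero) p) = there (∈-++⁺ʳ _ (∈-map⁺ _ (∈-allPos p)))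
  ∈-allPos {∁ _}   (down zero p)       = there (∈-map⁺ _ (∈-allPos p))
  ∈-allPos {_ ⋆}   (down zero p)       = there (∈-map⁺ _ (∈-allPos p))

  ∃-Pos? : ∀ {r : ERE A} {ℓ} {P : Pred (Pos r) ℓ} → Decidable P → Dec (∃ P)
  ∃-Pos? {r} P? = map′ satisfied (λ (p , Pp) → lose (∈-allPos p) Pp) (any? P? (allPos r))

  -- ¬ LeafCluster x is only a double negation; it is removed by searching the finite tree.
  extendedNode-of-cluster : ∀ {r : ERE A} (x : Pos r) → ¬ LeafCluster x →
                            Σ (Pos r) λ y → SameCluster x y × IsExtended y
  extendedNode-of-cluster x ¬leaf =
    decidable-stable (∃-Pos? λ y → SameCluster? x y ×-dec IsExtended? y)
      λ ¬found → ¬leaf λ (y , x~y , ext , _) → ¬found (y , x~y , ext)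

  liftTops : (r : ERE A) (i : Fin (arity r)) → List (Pos (child r i)) → List (Pos r)
  liftTops r i ts = (if isExtendedRoot r then [ down i root ] else []) ++ map (down i) ts

  externalChildren : (r : ERE A) → List (Pos r)
  externalChildren (chr _) = []
  externalChildren eps     = []
  externalChildren (r ⊙ s) = liftTops (r ⊙ s) zero (externalChildren r) ++ liftTops (r ⊙ s) (suc zero) (externalChildren s)
  externalChildren (r ∣ s) = liftTops (r ∣ s) zero (externalChildren r) ++ liftTops (r ∣ s) (suc zero) (externalChildren s)
  externalChildren (r ∩ s) = liftTops (r ∩ s) zero (externalChildren r) ++ liftTops (r ∩ s) (suc zero) (externalChildren s)
  externalChildren (∁ r)   = liftTops (∁ r) zero (externalChildren r)
  externalChildren (r ⋆)   = liftTops (r ⋆) zero (externalChildren r)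

  liftTop∈ : (r : ERE A) (i : Fin (arity r)) {ts : List (Pos (child r i))} {t : Pos (child r i)} →
             t ∈ root ∷ ts → liftTop r i t ∈ root ∷ liftTops r i ts
  liftTop∈ r i {t = root} _ with isExtendedRoot r
  ... | true  = there (here refl)
  ... | false = here refl
  liftTop∈ r i {t = down _ _} (there t∈ts) = there (∈-++⁺ʳ _ (∈-map⁺ (down i) t∈ts))

  liftTops⊆externalChildren : (r : ERE A) (i : Fin (arity r)) →
                              liftTops r i (externalChildren (child r i)) ⊆ externalChildren r
  liftTops⊆externalChildren (_ ⊙ _) zero       = ∈-++⁺ˡ
  liftTops⊆externalChildren (r ⊙ s) (suc zero) = ∈-++⁺ʳ (liftTops (r ⊙ s) zero (externalChildren r))
  liftTops⊆externalChildren (_ ∣ _) zero       = ∈-++⁺ˡ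
  liftTops⊆externalChildren (r ∣ s) (suc zero) = ∈-++⁺ʳ (liftTops (r ∣ s) zero (externalChildren r))
  liftTops⊆externalChildren (_ ∩ _) zero       = ∈-++⁺ˡ
  liftTops⊆externalChildren (r ∩ s) (suc zero) = ∈-++⁺ʳ (liftTops (r ∩ s) zero (externalChildren r))
  liftTops⊆externalChildren (∁ _)   zero       = λ t∈ → t∈
  liftTops⊆externalChildren (_ ⋆)   zero       = λ t∈ → t∈

  clusterTop∈ : ∀ {r : ERE A} (p : Pos r) → clusterTop p ∈ root ∷ externalChildren r
  clusterTop∈ root           = here refl
  clusterTop∈ {r} (down i p) = ∷⁺ʳ root (liftTops⊆externalChildren r i) (liftTop∈ r i (clusterTop∈ p))

  length-liftTops : (r : ERE A) (i : Fin (arity r)) (ts : List (Pos (child r i))) →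
                    length (liftTops r i ts) ≡ (if isExtendedRoot r then suc (length ts) else length ts)
  length-liftTops r i ts with isExtendedRoot r
  ... | true  = cong suc (length-map (down i) ts)
  ... | false = length-map (down i) ts

  length-liftTops-++ : (r : ERE A) (i j : Fin (arity r)) (ts : List (Pos (child r i))) (us : List (Pos (child r j))) →
    length (liftTops r i ts ++ liftTops r j us) ≡
    (if isExtendedRoot r then suc (length ts) else length ts) + (if isExtendedRoot r then suc (length us) else length us)
  length-liftTops-++ r i j ts us =
    trans (length-++ (liftTops r i ts)) (cong₂ _+_ (length-liftTops r i ts) (length-liftTops r j us))

  externalChildren-bound : (r : ERE A) → ExtChildrenBound (containsExtOp r) (length (externalChildren r)) (numExt r)
  externalChildren-bound (chr _) = refl
  externalChildren-bound eps     = refl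
  externalChildren-bound (r ⊙ s)
    rewrite length-liftTops-++ (r ⊙ s) zero (suc zero) (externalChildren r) (externalChildren s) =
    ExtChildrenBound-binary (containsExtOp r) (containsExtOp s) (externalChildren-bound r) (externalChildren-bound s)
  externalChildren-bound (r ∣ s)
    rewrite length-liftTops-++ (r ∣ s) zero (suc zero) (externalChildren r) (externalChildren s) =
    ExtChildrenBound-binary (containsExtOp r) (containsExtOp s) (externalChildren-bound r) (externalChildren-bound s)
  externalChildren-bound (r ∩ s)
    rewrite length-liftTops-++ (r ∩ s) zero (suc zero) (externalChildren r) (externalChildren s) =
    ExtChildrenBound-∩ {k₁ = numExt r} {numExt s} (ExtChildrenBound⇒≤ _ (externalChildren-bound r)) (ExtChildrenBound⇒≤ _ (externalChildren-bound s))
  externalChildren-bound (∁ r) rewrite length-liftTops (∁ r) zero (externalChildren r) =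
    ExtChildrenBound-∁ (ExtChildrenBound⇒≤ _ (externalChildren-bound r))
  externalChildren-bound (r ⋆) rewrite length-liftTops (r ⋆) zero (externalChildren r) =
    externalChildren-bound r

  externalChildren-length≤ : (r : ERE A) → length (externalChildren r) ≤ 4 * numExt r
  externalChildren-length≤ r = ExtChildrenBound⇒≤ (containsExtOp r) (externalChildren-bound r)

  clusters-length≤ : (R : ERE A) (cs : List (Pos R)) → AllPairs (λ x y → ¬ SameCluster x y) cs →
                     length cs ≤ 4 * (numExt R + 1)
  clusters-length≤ R cs distinct = begin
    length cs                              ≡⟨ length-map clusterTop cs ⟨
    length (map clusterTop cs)             ≤⟨ Unique⇒length≤ distinctTops tops⊆ ⟩
    suc (length (externalChildren R))      ≤⟨ s≤s (externalChildren-length≤ R) ⟩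
    suc (4 * numExt R)                     ≡⟨ +-comm 1 (4 * numExt R) ⟩
    4 * numExt R + 1                       ≤⟨ +-monoʳ-≤ (4 * numExt R) (s≤s z≤n) ⟩
    4 * numExt R + 4 * 1                   ≡⟨ *-distribˡ-+ 4 (numExt R) 1 ⟨
    4 * (numExt R + 1)                     ∎
    where
    open ≤-Reasoning
    distinctTops : Unique (map clusterTop cs)
    distinctTops = Unique.map⁺ (EqClosure.setoid InternalEdge) (setoid (Pos R)) clusterTop≡⇒SameCluster distinct
    tops⊆ : map clusterTop cs ⊆ root ∷ externalChildren R
    tops⊆ t∈ with ∈-map⁻ clusterTop t∈
    ... | x , _ , refl = clusterTop∈ x

lemma1 : (∀ {A : Set} (R : ERE A) (x : Pos R) → LeafCluster x →
            ∀ y → SameCluster x y → ¬ IsExtended y)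
       × (∀ {A : Set} (R : ERE A) (x : Pos R) → ¬ LeafCluster x →
            Σ (Pos R) λ y → SameCluster x y × IsExtended y ×
              (∀ z → SameCluster x z → IsExtended z → z ≡ y))
       × (Σ ℕ λ c → ∀ {A : Set} (R : ERE A) (cs : List (Pos R)) →
            AllPairs (λ x y → ¬ SameCluster x y) cs →
            length cs ≤ c * (numExt R + 1))
lemma1 = leafClusters , internalClusters , (4 , clusters-length≤)
  where
  leafClusters : ∀ {A : Set} (R : ERE A) (x : Pos R) → LeafCluster x → ∀ y → SameCluster x y → ¬ IsExtended y
  leafClusters R x leaf y x~y ext = leaf (y , x~y , ext , IsExtended⇒child y ext)

  internalClusters : ∀ {A : Set} (R : ERE A) (x : Pos R) → ¬ LeafCluster x →
    Σ (Pos R) λ y → SameCluster x y × IsExtended y × (∀ z → SameCluster x z → IsExtended z → z ≡ y)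
  internalClusters R x ¬leaf =
    let y , x~y , ext = extendedNode-of-cluster x ¬leaf
    in y , x~y , ext , λ z x~z extz → IsExtended-unique-in-cluster x~y x~z ext extz
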